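{- Let $G$ be a nice graph, $V_4$ the set of vertices of degree at least $4$ in $G$, $\mathcal{P}$ a path partition of $G$ of minimum size, and $\mathcal{P}_4\subseteq\mathcal{P}$ the subfamily of paths that visit at least one vertex of $V_4$. Then $\mathcal{P}_4$ is bull-free.
   Context: All graphs are finite, simple and undirected; subcubic means maximum degree at most $3$. A path partition of $G$ is a collection of pairwise edge-disjoint paths whose edge sets together cover $E(G)$. A cycle $C$ in $G$ is a pan cycle if exactly one vertex of $C$ has degree $3$ in $G$ and all others have degree $2$ in $G$; it is a bull cycle if exactly two vertices of $C$ have degree $3$ in $G$ and all others have degree $2$ in $G$. A graph is nice if it is connected, not subcubic, has no pan cycles, and every bull cycle has length $3$. A bull triangle is a bull cycle of length $3$; its two degree-$3$ vertices form a bull-pair. A path is bull-free if its two endpoints do not form a bull-pair; a family of paths is bull-free if each of its paths is. -}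

module Defs where

open import Data.Nat using (ℕ; zero; suc; _+_; _≤_; _≟_)
open import Data.Bool using (Bool; true; false; if_then_else_)
open import Data.Fin using (Fin)
open import Data.List using (List; []; _∷_; length; lookup; allFin; map; filter)
open import Data.Nat.ListAction using (sum)
open import Data.List.Relation.Unary.All using (All)
open import Data.List.Relation.Unary.Linked using (Linked)
open import Data.List.Relation.Unary.Unique.Propositional using (Unique)
open import Data.List.Membership.Propositional using (_∈_)
open import Data.Product using (Σ; ∃; _×_; _,_)
open import Data.Sum using (_⊎_)
open import Data.Empty using (⊥)
open import Data.Unit using (⊤)
open import Relation.Nullary using (¬_)
open import Relation.Binary.PropositionalEquality using (_≡_; _≢_)

record Graph (n : ℕ) : Set where
  field
    adj    : Fin n → Fin n → Bool
    sym    : ∀ u v → adj u v ≡ adj v u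
    irrefl : ∀ v → adj v v ≡ false

module _ {n : ℕ} (G : Graph n) where
  open Graph G

  Adj : Fin n → Fin n → Set
  Adj u v = adj u v ≡ true

  deg : Fin n → ℕ
  deg v = sum (map (λ u → if adj v u then 1 else 0) (allFin n))

  lastOr : Fin n → List (Fin n) → Fin n
  lastOr x []       = x
  lastOr x (y ∷ ys) = lastOr y ys

  Connected : Set
  Connected = ∀ u v → ∃ λ (xs : List (Fin n)) → Linked Adj (u ∷ xs) × lastOr u xs ≡ v

  IsPath : List (Fin n) → Set
  IsPath p = Linked Adj p × Unique p × 2 ≤ length p

  data Consec (u v : Fin n) : List (Fin n) → Set where
    here  : ∀ {zs} → Consec u v (u ∷ v ∷ zs)
    there : ∀ {z zs} → Consec u v zs → Consec u v (z ∷ zs)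

  EdgeOf : List (Fin n) → Fin n → Fin n → Set
  EdgeOf p u v = Consec u v p ⊎ Consec v u p

  PathPartition : List (List (Fin n)) → Set
  PathPartition P =
      All IsPath P
    × (∀ (i j : Fin (length P)) → i ≢ j → ∀ u v →
         EdgeOf (lookup P i) u v → ¬ EdgeOf (lookup P j) u v)
    × (∀ u v → Adj u v → ∃ λ (i : Fin (length P)) → EdgeOf (lookup P i) u v)

  IsCycle : List (Fin n) → Set
  IsCycle []       = ⊥
  IsCycle (x ∷ xs) = Linked Adj (x ∷ xs) × Unique (x ∷ xs) × 3 ≤ length (x ∷ xs)
                     × Adj (lastOr x xs) x

  count3 : List (Fin n) → ℕ
  count3 c = length (filter (λ v → deg v ≟ 3) c)

  Deg23 : Fin n → Set
  Deg23 v = deg v ≡ 2 ⊎ deg v ≡ 3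

  PanCycle : List (Fin n) → Set
  PanCycle c = IsCycle c × All Deg23 c × count3 c ≡ 1

  BullCycle : List (Fin n) → Set
  BullCycle c = IsCycle c × All Deg23 c × count3 c ≡ 2

  Nice : Set
  Nice = Connected
       × (∃ λ v → 4 ≤ deg v)
       × (∀ c → ¬ PanCycle c)
       × (∀ c → BullCycle c → length c ≡ 3)

  BullPair : Fin n → Fin n → Set
  BullPair x y = ∃ λ c → BullCycle c × length c ≡ 3 × x ∈ c × y ∈ c × x ≢ y
                         × deg x ≡ 3 × deg y ≡ 3

  BullFreePath : List (Fin n) → Set
  BullFreePath []       = ⊤
  BullFreePath (x ∷ xs) = ¬ BullPair x (lastOr x xs)

-- Let p ∈ P run from x to y, where x y z is a bull triangle (deg x = deg y = 3, deg z = 2).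
-- If p is x y or x z y, every vertex of p has degree at most 3.  Otherwise p leaves x through
-- a vertex a outside T = {x, y, z}; then p has no edge inside T, while the only edges leaving T,
-- namely x a and b y (b the predecessor of y), lie on p.  So every other path of P meeting T
-- lies inside T, and there are at least two of them since no path contains a whole triangle.
-- Replacing p and these paths by z p and x y z gives a smaller path partition.

module Submission where

open import Defs
open import Data.Nat using (ℕ; suc; _+_; _≤_; _<_; z≤n; s≤s) renaming (_≟_ to _≟ℕ_)
open import Data.Nat.Properties using (≤-trans; ≤-reflexive; +-suc; <-irrefl; +-monoˡ-≤; n≤1+n; ≤⇒≯; <⇒≱)
open import Data.Bool using (Bool; true; false; if_then_else_) renaming (_≟_ to _≟ᵇ_)
open import Data.Fin using (Fin; zero; suc)
open import Data.Fin.Properties using (_≟_)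
open import Data.List using (List; []; _∷_; length; lookup; allFin; map; filter)
open import Data.List.Properties using (tabulate-lookup; ≡-dec)
open import Data.Nat.ListAction using (sum)
open import Data.List.Relation.Unary.All as All using (All; []; _∷_)
open import Data.List.Relation.Unary.All.Properties as All using (¬Any⇒All¬)
open import Data.List.Relation.Unary.Any as Any using (Any; here; there; _─_; any?)
open import Data.List.Relation.Unary.Any.Properties using (lookup-index)
open import Data.List.Relation.Unary.AllPairs using (AllPairs; []; _∷_)
open import Data.List.Relation.Unary.AllPairs.Properties as AllPairs using (tabulate⁺)
open import Data.List.Relation.Unary.Linked using (Linked; [-]; _∷_)
open import Data.List.Relation.Unary.Unique.Propositional using (Unique)
open import Data.List.Membership.Propositional using (_∈_; _∉_)
open import Data.List.Membership.Propositional.Properties using (∈-lookup; ∈-allFin; ∈-filter⁺; ∈-filter⁻)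
open import Data.Product using (∃; _×_; _,_; proj₁; proj₂)
open import Data.Sum using (_⊎_; inj₁; inj₂)
open import Data.Empty using (⊥; ⊥-elim)
open import Data.Unit using (tt)
open import Function using (_∘_)
open import Level using (0ℓ)
open import Relation.Binary using (Rel; Symmetric)
open import Relation.Nullary using (¬_; yes; no; contradiction)
open import Relation.Unary using (Pred; Decidable)
open import Relation.Unary.Properties using (∁?)
open import Relation.Binary.PropositionalEquality
  using (_≡_; _≢_; refl; sym; trans; cong; subst; ≢-sym)

module _ {A : Set} where

  ∈-─ : ∀ {x y : A} {xs} (x∈xs : x ∈ xs) → y ∈ xs → y ≢ x → y ∈ (xs ─ x∈xs)
  ∈-─ (here refl)  (here refl)  y≢x = ⊥-elim (y≢x refl)
  ∈-─ (here refl)  (there y∈xs) _   = y∈xs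
  ∈-─ (there _)    (here refl)  _   = here refl
  ∈-─ (there x∈xs) (there y∈xs) y≢x = there (∈-─ x∈xs y∈xs y≢x)

  module _ {P : Pred A 0ℓ} (P? : Decidable P) where

    length-filter-─ : ∀ {x xs} → P x → (x∈xs : x ∈ xs) →
                      length (filter P? xs) ≡ suc (length (filter P? (xs ─ x∈xs)))
    length-filter-─ {x} px (here refl) with P? x
    ... | yes _  = refl
    ... | no ¬px = contradiction px ¬px
    length-filter-─ px (there {x = y} x∈xs) with P? y
    ... | yes _ = cong suc (length-filter-─ px x∈xs)
    ... | no _  = length-filter-─ px x∈xs

    length-filter+length-filter-∁ : ∀ xs →
      length (filter P? xs) + length (filter (∁? P?) xs) ≡ length xs
    length-filter+length-filter-∁ []       = refl
    length-filter+length-filter-∁ (x ∷ xs) with P? x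
    ... | yes _ = cong suc (length-filter+length-filter-∁ xs)
    ... | no _  = trans (+-suc _ _) (cong suc (length-filter+length-filter-∁ xs))

    Unique-⊆⇒length≤length-filter : ∀ {ds xs} → Unique ds → All P ds →
      (∀ {d} → d ∈ ds → d ∈ xs) → length ds ≤ length (filter P? xs)
    Unique-⊆⇒length≤length-filter {[]} _ _ _ = z≤n
    Unique-⊆⇒length≤length-filter {d ∷ ds} {xs} (d∉ds ∷ ds!) (pd ∷ pds) ds⊆xs =
      ≤-trans (s≤s (Unique-⊆⇒length≤length-filter ds! pds ds⊆xs─d))
              (≤-reflexive (sym (length-filter-─ pd d∈xs)))
      where
      d∈xs : d ∈ xs
      d∈xs = ds⊆xs (here refl)
      ds⊆xs─d : ∀ {e} → e ∈ ds → e ∈ (xs ─ d∈xs)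
      ds⊆xs─d e∈ds = ∈-─ d∈xs (ds⊆xs (there e∈ds)) (≢-sym (All.lookup d∉ds e∈ds))

  sum-indicator≡length-filter : (f : A → Bool) (xs : List A) →
    sum (map (λ u → if f u then 1 else 0) xs) ≡ length (filter (λ u → f u ≟ᵇ true) xs)
  sum-indicator≡length-filter f []       = refl
  sum-indicator≡length-filter f (x ∷ xs) with f x
  ... | true  = cong suc (sum-indicator≡length-filter f xs)
  ... | false = sum-indicator≡length-filter f xs

  module _ {R : Rel A 0ℓ} (R-sym : Symmetric R) where

    AllPairs-lookup : ∀ {xs} → AllPairs R xs →
                      ∀ {i j : Fin (length xs)} → i ≢ j → R (lookup xs i) (lookup xs j)
    AllPairs-lookup (_ ∷ _)   {zero}  {zero}  i≢j = ⊥-elim (i≢j refl)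
    AllPairs-lookup (Rx ∷ _)  {zero}  {suc j} _   = All.lookup Rx (∈-lookup j)
    AllPairs-lookup (Rx ∷ _)  {suc i} {zero}  _   = R-sym (All.lookup Rx (∈-lookup i))
    AllPairs-lookup (_ ∷ Rxs) {suc i} {suc j} i≢j = AllPairs-lookup Rxs (i≢j ∘ cong suc)

    AllPairs-separated : ∀ {Q : Pred A 0ℓ} {xs u v} → AllPairs R xs →
                         u ∈ xs → v ∈ xs → Q u → ¬ Q v → R u v
    AllPairs-separated _         (here refl) (here refl) qu ¬qv = contradiction qu ¬qv
    AllPairs-separated (Ru ∷ _)  (here refl) (there v∈)  _  _   = All.lookup Ru v∈
    AllPairs-separated (Rv ∷ _)  (there u∈)  (here refl) _  _   = R-sym (All.lookup Rv u∈)
    AllPairs-separated (_ ∷ Rxs) (there u∈)  (there v∈)  qu ¬qv = AllPairs-separated Rxs u∈ v∈ qu ¬qv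

  third-member : ∀ {a b c x y : A} → Unique (a ∷ b ∷ c ∷ []) →
    x ∈ a ∷ b ∷ c ∷ [] → y ∈ a ∷ b ∷ c ∷ [] → x ≢ y →
    ∃ λ z → z ∈ a ∷ b ∷ c ∷ [] × x ≢ z × y ≢ z
  third-member ((a≢b ∷ a≢c ∷ []) ∷ (b≢c ∷ []) ∷ [] ∷ []) = go
    where
    go : ∀ {x y} → x ∈ _ → y ∈ _ → x ≢ y → ∃ λ z → z ∈ _ × x ≢ z × y ≢ z
    go (here refl)                 (here refl)                 x≢y = ⊥-elim (x≢y refl)
    go (here refl)                 (there (here refl))         _   = _ , there (there (here refl)) , a≢c , b≢c
    go (here refl)                 (there (there (here refl))) _   = _ , there (here refl) , a≢b , ≢-sym b≢c
    go (there (here refl))         (here refl)                 _   = _ , there (there (here refl)) , b≢c , a≢c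
    go (there (here refl))         (there (here refl))         x≢y = ⊥-elim (x≢y refl)
    go (there (here refl))         (there (there (here refl))) _   = _ , here refl , ≢-sym a≢b , ≢-sym a≢c
    go (there (there (here refl))) (here refl)                 _   = _ , there (here refl) , ≢-sym b≢c , a≢b
    go (there (there (here refl))) (there (here refl))         _   = _ , here refl , ≢-sym a≢c , ≢-sym a≢b
    go (there (there (here refl))) (there (there (here refl))) x≢y = ⊥-elim (x≢y refl)

module _ {n : ℕ} (G : Graph n) where

  Adj-sym : ∀ {u v} → Adj G u v → Adj G v u
  Adj-sym {u} {v} uv = trans (Graph.sym G v u) uv

  Adj⇒≢ : ∀ {u v} → Adj G u v → u ≢ v
  Adj⇒≢ {u} uu refl with trans (sym uu) (Graph.irrefl G u)
  ... | ()

  length≤deg : ∀ {w L} → Unique L → All (Adj G w) L → length L ≤ deg G w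
  length≤deg {w} {L} L! w~L =
    subst (length L ≤_) (sym (sum-indicator≡length-filter (Graph.adj G w) (allFin n)))
          (Unique-⊆⇒length≤length-filter (λ u → Graph.adj G w u ≟ᵇ true) L! w~L (λ _ → ∈-allFin _))

  neighbours-complete : ∀ {w L v} → Unique L → All (Adj G w) L → deg G w ≡ length L →
                        Adj G w v → v ∈ L
  neighbours-complete {w} {L} {v} L! w~L deg-w wv with any? (v ≟_) L
  ... | yes v∈L = v∈L
  ... | no v∉L  = ⊥-elim (<-irrefl (sym deg-w) (length≤deg (¬Any⇒All¬ L v∉L ∷ L!) (wv ∷ w~L)))

  triangle-adj : ∀ {a b c u v} → Adj G a b → Adj G b c → Adj G c a →
    u ∈ a ∷ b ∷ c ∷ [] → v ∈ a ∷ b ∷ c ∷ [] → u ≢ v → Adj G u v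
  triangle-adj _  _  _  (here refl)                 (here refl)                 u≢v = ⊥-elim (u≢v refl)
  triangle-adj ab _  _  (here refl)                 (there (here refl))         _   = ab
  triangle-adj _  _  ca (here refl)                 (there (there (here refl))) _   = Adj-sym ca
  triangle-adj ab _  _  (there (here refl))         (here refl)                 _   = Adj-sym ab
  triangle-adj _  _  _  (there (here refl))         (there (here refl))         u≢v = ⊥-elim (u≢v refl)
  triangle-adj _  bc _  (there (here refl))         (there (there (here refl))) _   = bc
  triangle-adj _  _  ca (there (there (here refl))) (here refl)                 _   = ca
  triangle-adj _  bc _  (there (there (here refl))) (there (here refl))         _   = Adj-sym bc
  triangle-adj _  _  _  (there (there (here refl))) (there (there (here refl))) u≢v = ⊥-elim (u≢v refl)

  record BullTriangle (x y z : Fin n) : Set where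
    field
      xy    : Adj G x y
      yz    : Adj G y z
      xz    : Adj G x z
      deg-x : deg G x ≡ 3
      deg-y : deg G y ≡ 3
      deg-z : deg G z ≡ 2

  bullPair⇒BullTriangle : ∀ {x y} → BullPair G x y → ∃ (BullTriangle x y)
  bullPair⇒BullTriangle
    (c₀ ∷ c₁ ∷ c₂ ∷ [] , (((c₀c₁ ∷ c₁c₂ ∷ [-]) , c! , _ , c₂c₀) , c-deg , count≡2) ,
     refl , x∈c , y∈c , x≢y , deg-x , deg-y)
    with third-member c! x∈c y∈c x≢y
  ... | z , z∈c , x≢z , y≢z = z , record
    { xy = adj x∈c y∈c x≢y ; yz = adj y∈c z∈c y≢z ; xz = adj x∈c z∈c x≢z
    ; deg-x = deg-x ; deg-y = deg-y ; deg-z = deg-z }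
    where
    adj : ∀ {u v} → u ∈ c₀ ∷ c₁ ∷ c₂ ∷ [] → v ∈ c₀ ∷ c₁ ∷ c₂ ∷ [] → u ≢ v → Adj G u v
    adj = triangle-adj c₀c₁ c₁c₂ c₂c₀
    deg-z : deg G z ≡ 2
    deg-z with All.lookup c-deg z∈c
    ... | inj₁ d = d
    ... | inj₂ d = contradiction (subst (3 ≤_) count≡2 three-of-degree-3) λ { (s≤s (s≤s ())) }
      where
      three-of-degree-3 : 3 ≤ count3 G (c₀ ∷ c₁ ∷ c₂ ∷ [])
      three-of-degree-3 = Unique-⊆⇒length≤length-filter (λ v → deg G v ≟ℕ 3)
        ((x≢y ∷ x≢z ∷ []) ∷ (y≢z ∷ []) ∷ [] ∷ []) (deg-x ∷ deg-y ∷ d ∷ [])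
        λ { (here refl) → x∈c ; (there (here refl)) → y∈c ; (there (there (here refl))) → z∈c }

  last-∈ : ∀ u us → lastOr G u us ∈ u ∷ us
  last-∈ u []       = here refl
  last-∈ u (v ∷ vs) = there (last-∈ v vs)

  lastOr≡head⇒[] : ∀ {u us} → Unique (u ∷ us) → lastOr G u us ≡ u → us ≡ []
  lastOr≡head⇒[] {us = []}     _          _ = refl
  lastOr≡head⇒[] {us = v ∷ vs} (u∉us ∷ _) e = ⊥-elim (All.lookup u∉us (last-∈ v vs) (sym e))

  consec-∈ : ∀ {u v l} → Consec G u v l → u ∈ l × v ∈ l
  consec-∈ here      = here refl , there (here refl)
  consec-∈ (there c) = there (proj₁ (consec-∈ c)) , there (proj₂ (consec-∈ c))

  consec-adj : ∀ {u v l} → Linked (Adj G) l → Consec G u v l → Adj G u v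
  consec-adj (uv ∷ _) here      = uv
  consec-adj (_ ∷ l~) (there c) = consec-adj l~ c
  consec-adj [-]      (there ())

  predecessor : ∀ {h t v} → v ∈ t → ∃ λ u → Consec G u v (h ∷ t)
  predecessor (here refl) = _ , here
  predecessor (there v∈t) = proj₁ (predecessor v∈t) , there (proj₂ (predecessor v∈t))

  head-no-predecessor : ∀ {h t u} → Unique (h ∷ t) → ¬ Consec G u h (h ∷ t)
  head-no-predecessor (h∉t ∷ _) here      = All.lookup h∉t (here refl) refl
  head-no-predecessor (h∉t ∷ _) (there c) = All.lookup h∉t (proj₂ (consec-∈ c)) refl

  last-no-successor : ∀ {h t u v} → Unique (h ∷ t) → Consec G u v (h ∷ t) → u ≢ lastOr G h t
  last-no-successor {t = w ∷ t} (h∉t ∷ _) here      e = All.lookup h∉t (last-∈ w t) e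
  last-no-successor {t = _ ∷ _} (_ ∷ t!)  (there c) e = last-no-successor t! c e

  successor-unique : ∀ {u v v′ l} → Unique l → Consec G u v l → Consec G u v′ l → v ≡ v′
  successor-unique _        here      here       = refl
  successor-unique (u∉ ∷ _) here      (there c)  = ⊥-elim (All.lookup u∉ (proj₁ (consec-∈ c)) refl)
  successor-unique (u∉ ∷ _) (there c) here       = ⊥-elim (All.lookup u∉ (proj₁ (consec-∈ c)) refl)
  successor-unique (_ ∷ l!) (there c) (there c′) = successor-unique l! c c′

  predecessor-unique : ∀ {u u′ v l} → Unique l → Consec G u v l → Consec G u′ v l → u ≡ u′
  predecessor-unique _        here      here       = refl
  predecessor-unique (_ ∷ l!) here      (there c)  = ⊥-elim (head-no-predecessor l! c)
  predecessor-unique (_ ∷ l!) (there c) here       = ⊥-elim (head-no-predecessor l! c)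
  predecessor-unique (_ ∷ l!) (there c) (there c′) = predecessor-unique l! c c′

  no-consec-triangle : ∀ {u v w l} → Unique l → Consec G u v l → Consec G v w l → ¬ Consec G w u l
  no-consec-triangle l!       here      _          wu        = head-no-predecessor l! wu
  no-consec-triangle l!       (there c) here       wu        = head-no-predecessor l! (there c)
  no-consec-triangle l!       (there c) (there c′) here      = head-no-predecessor l! (there c′)
  no-consec-triangle (_ ∷ l!) (there c) (there c′) (there c″) = no-consec-triangle l! c c′ c″

  edge-adj : ∀ {u v l} → Linked (Adj G) l → EdgeOf G l u v → Adj G u v
  edge-adj l~ (inj₁ c) = consec-adj l~ c
  edge-adj l~ (inj₂ c) = Adj-sym (consec-adj l~ c)

  edge-∈ : ∀ {u v l} → EdgeOf G l u v → u ∈ l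
  edge-∈ (inj₁ c) = proj₁ (consec-∈ c)
  edge-∈ (inj₂ c) = proj₂ (consec-∈ c)

  edge-sym : ∀ {u v l} → EdgeOf G l u v → EdgeOf G l v u
  edge-sym (inj₁ c) = inj₂ c
  edge-sym (inj₂ c) = inj₁ c

  edge-∷ : ∀ {h u v l} → EdgeOf G l u v → EdgeOf G (h ∷ l) u v
  edge-∷ (inj₁ c) = inj₁ (there c)
  edge-∷ (inj₂ c) = inj₂ (there c)

  edge-∷⁻ : ∀ {h k t u v} → EdgeOf G (h ∷ k ∷ t) u v →
            (u ≡ h × v ≡ k) ⊎ (u ≡ k × v ≡ h) ⊎ EdgeOf G (k ∷ t) u v
  edge-∷⁻ (inj₁ here)      = inj₁ (refl , refl)
  edge-∷⁻ (inj₂ here)      = inj₂ (inj₁ (refl , refl))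
  edge-∷⁻ (inj₁ (there c)) = inj₂ (inj₂ (inj₁ c))
  edge-∷⁻ (inj₂ (there c)) = inj₂ (inj₂ (inj₂ c))

  edge-∋-middle : ∀ {a b c u v} → EdgeOf G (a ∷ b ∷ c ∷ []) u v → u ≡ b ⊎ v ≡ b
  edge-∋-middle (inj₁ here)         = inj₂ refl
  edge-∋-middle (inj₁ (there here)) = inj₁ refl
  edge-∋-middle (inj₂ here)         = inj₁ refl
  edge-∋-middle (inj₂ (there here)) = inj₂ refl
  edge-∋-middle (inj₁ (there (there (there ()))))
  edge-∋-middle (inj₂ (there (there (there ()))))

  triangle⊈path : ∀ {u v w l} → IsPath G l →
                  EdgeOf G l u v → EdgeOf G l v w → EdgeOf G l u w → ⊥
  triangle⊈path {l = l} (l~ , l! , _) = go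
    where
    go : ∀ {u v w} → EdgeOf G l u v → EdgeOf G l v w → EdgeOf G l u w → ⊥
    go (inj₁ uv) vw        (inj₁ uw)   = Adj⇒≢ (edge-adj l~ vw) (successor-unique l! uv uw)
    go (inj₂ vu) vw        (inj₂ wu)   = Adj⇒≢ (edge-adj l~ vw) (predecessor-unique l! vu wu)
    go (inj₁ uv) (inj₁ vw) (inj₂ wu)   = no-consec-triangle l! uv vw wu
    go (inj₁ uv) (inj₂ wv) uw@(inj₂ _) = Adj⇒≢ (edge-adj l~ uw) (predecessor-unique l! uv wv)
    go (inj₂ vu) (inj₁ vw) uw@(inj₁ _) = Adj⇒≢ (edge-adj l~ uw) (successor-unique l! vu vw)
    go (inj₂ vu) (inj₂ wv) (inj₁ uw)   = no-consec-triangle l! vu uw wv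

  edge-closed-Any⇒All : ∀ {Q : Pred (Fin n) 0ℓ} l →
    (∀ {u v} → EdgeOf G l u v → Q u → Q v) → Any Q l → All Q l
  edge-closed-Any⇒All (_ ∷ [])    _    (here qh) = qh ∷ []
  edge-closed-Any⇒All (_ ∷ k ∷ t) step (here qh) =
    qh ∷ edge-closed-Any⇒All (k ∷ t) (step ∘ edge-∷) (here (step (inj₁ here) qh))
  edge-closed-Any⇒All (_ ∷ k ∷ t) step (there qt) with edge-closed-Any⇒All (k ∷ t) (step ∘ edge-∷) qt
  ... | qk ∷ qs = step (inj₂ here) qk ∷ qk ∷ qs

  EdgeDisjoint : Rel (List (Fin n)) 0ℓ
  EdgeDisjoint r s = ∀ u v → EdgeOf G r u v → ¬ EdgeOf G s u v

  EdgeDisjoint-sym : Symmetric EdgeDisjoint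
  EdgeDisjoint-sym r∥s u v e e′ = r∥s u v e′ e

  Covers : List (List (Fin n)) → Set
  Covers P = ∀ u v → Adj G u v → ∃ λ q → q ∈ P × EdgeOf G q u v

  PathPartition⇒AllPairs : ∀ {P} → PathPartition G P → AllPairs EdgeDisjoint P
  PathPartition⇒AllPairs {P} (_ , disjoint , _) =
    subst (AllPairs EdgeDisjoint) (tabulate-lookup P) (tabulate⁺ (disjoint _ _))

  PathPartition⇒Covers : ∀ {P} → PathPartition G P → Covers P
  PathPartition⇒Covers (_ , _ , cover) u v uv with cover u v uv
  ... | i , e = _ , ∈-lookup i , e

  PathPartition-intro : ∀ {P} → All (IsPath G) P → AllPairs EdgeDisjoint P → Covers P →
                        PathPartition G P
  PathPartition-intro {P} paths disjoint covers =
    paths , (λ _ _ → AllPairs-lookup EdgeDisjoint-sym disjoint) , index-cover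
    where
    index-cover : ∀ u v → Adj G u v → ∃ λ i → EdgeOf G (lookup P i) u v
    index-cover u v uv with covers u v uv
    ... | q , q∈P , e = Any.index q∈P , subst (λ r → EdgeOf G r u v) (lookup-index q∈P) e

module Exchange {n : ℕ} (G : Graph n) {x y z : Fin n} (triangle : BullTriangle G x y z) where
  open BullTriangle triangle

  T : List (Fin n)
  T = x ∷ y ∷ z ∷ []

  x∈T : x ∈ T
  x∈T = here refl
  y∈T : y ∈ T
  y∈T = there (here refl)
  z∈T : z ∈ T
  z∈T = there (there (here refl))

  x≢y : x ≢ y
  x≢y = Adj⇒≢ G xy
  y≢z : y ≢ z
  y≢z = Adj⇒≢ G yz
  x≢z : x ≢ z
  x≢z = Adj⇒≢ G xz

  T-path : IsPath G T
  T-path = (xy ∷ yz ∷ [-]) , ((x≢y ∷ x≢z ∷ []) ∷ (y≢z ∷ []) ∷ [] ∷ []) , s≤s (s≤s z≤n)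

  deg≤3 : ∀ {v} → v ∈ T → deg G v ≤ 3
  deg≤3 (here refl)                 = ≤-reflexive deg-x
  deg≤3 (there (here refl))         = ≤-reflexive deg-y
  deg≤3 (there (there (here refl))) = ≤-trans (≤-reflexive deg-z) (n≤1+n 2)

  neighbours-z : ∀ {v} → Adj G z v → v ∈ x ∷ y ∷ []
  neighbours-z = neighbours-complete G ((x≢y ∷ []) ∷ [] ∷ []) (Adj-sym G xz ∷ Adj-sym G yz ∷ []) deg-z

  Meets : Pred (List (Fin n)) 0ℓ
  Meets r = Any (_∈ T) r

  meets? : Decidable Meets
  meets? = any? (λ v → any? (v ≟_) T)

  meets : ∀ {u r} → u ∈ r → u ∈ T → Meets r
  meets u∈r u∈T = Any.map (λ { refl → u∈T }) u∈r

  module Detour {a rest} (p-path : IsPath G (x ∷ a ∷ rest))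
                (p-ends : lastOr G a rest ≡ y) (a∉T : a ∉ T) where

    p : List (Fin n)
    p = x ∷ a ∷ rest

    p~ : Linked (Adj G) p
    p~ = proj₁ p-path

    p! : Unique p
    p! = proj₁ (proj₂ p-path)

    a≢ : ∀ {v} → v ∈ T → a ≢ v
    a≢ v∈T refl = a∉T v∈T

    neighbours-x : ∀ {v} → Adj G x v → v ∈ y ∷ z ∷ a ∷ []
    neighbours-x = neighbours-complete G
      ((y≢z ∷ ≢-sym (a≢ y∈T) ∷ []) ∷ (≢-sym (a≢ z∈T) ∷ []) ∷ [] ∷ [])
      (xy ∷ xz ∷ consec-adj G p~ here ∷ []) deg-x

    z∉p : z ∉ p
    z∉p (here z≡x) = x≢z (sym z≡x)
    z∉p (there z∈) with predecessor G {h = x} z∈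
    ... | u , u→z with neighbours-z (Adj-sym G (consec-adj G p~ u→z))
    ... | here refl         = a≢ z∈T (successor-unique G p! here u→z)
    ... | there (here refl) = last-no-successor G p! u→z (sym p-ends)

    b-consec : ∃ λ b → Consec G b y p
    b-consec = subst (λ v → ∃ λ b → Consec G b v p) p-ends (predecessor G (last-∈ G a rest))

    b : Fin n
    b = proj₁ b-consec

    b→y : Consec G b y p
    b→y = proj₂ b-consec

    x≢b : x ≢ b
    x≢b x≡b = a≢ y∈T (successor-unique G p! here (subst (λ u → Consec G u y p) (sym x≡b) b→y))

    z≢b : z ≢ b
    z≢b z≡b = z∉p (subst (_∈ p) (sym z≡b) (proj₁ (consec-∈ G b→y)))

    neighbours-y : ∀ {v} → Adj G y v → v ∈ x ∷ z ∷ b ∷ []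
    neighbours-y = neighbours-complete G
      ((x≢z ∷ x≢b ∷ []) ∷ (z≢b ∷ []) ∷ [] ∷ [])
      (Adj-sym G xy ∷ yz ∷ Adj-sym G (consec-adj G p~ b→y) ∷ []) deg-y

    no-consec-in-T : ∀ {u v} → u ∈ T → v ∈ T → ¬ Consec G u v p
    no-consec-in-T (here refl)                 v∈T c = a≢ v∈T (successor-unique G p! here c)
    no-consec-in-T (there (here refl))         _   c = last-no-successor G p! c (sym p-ends)
    no-consec-in-T (there (there (here refl))) _   c = z∉p (proj₁ (consec-∈ G c))

    no-edge-in-T : ∀ {u v} → EdgeOf G p u v → u ∈ T → v ∈ T → ⊥
    no-edge-in-T (inj₁ c) u∈T v∈T = no-consec-in-T u∈T v∈T c
    no-edge-in-T (inj₂ c) u∈T v∈T = no-consec-in-T v∈T u∈T c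

    p-meets : Meets p
    p-meets = here x∈T

    T-closed : ∀ {q u v} → Linked (Adj G) q → EdgeDisjoint G p q → EdgeOf G q u v → u ∈ T → v ∈ T
    T-closed q~ p∥q e (here refl) with neighbours-x (edge-adj G q~ e)
    ... | here refl                 = y∈T
    ... | there (here refl)         = z∈T
    ... | there (there (here refl)) = ⊥-elim (p∥q _ _ (inj₁ here) e)
    T-closed q~ p∥q e (there (here refl)) with neighbours-y (edge-adj G q~ e)
    ... | here refl                 = x∈T
    ... | there (here refl)         = z∈T
    ... | there (there (here refl)) = ⊥-elim (p∥q _ _ (inj₂ b→y) e)
    T-closed q~ p∥q e (there (there (here refl))) with neighbours-z (edge-adj G q~ e)
    ... | here refl         = x∈T
    ... | there (here refl) = y∈T

    module _ {P : List (List (Fin n))} (P-partition : PathPartition G P) (p∈P : p ∈ P) where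

      P-paths : All (IsPath G) P
      P-paths = proj₁ P-partition

      P-disjoint : AllPairs (EdgeDisjoint G) P
      P-disjoint = PathPartition⇒AllPairs G P-partition

      P-covers : Covers G P
      P-covers = PathPartition⇒Covers G P-partition

      meeting-path-⊆T : ∀ {q} → q ∈ P → q ≢ p → Meets q → All (_∈ T) q
      meeting-path-⊆T {q} q∈P q≢p = edge-closed-Any⇒All G _ (T-closed (proj₁ (All.lookup P-paths q∈P)) p∥q)
        where
        p∥q : EdgeDisjoint G p q
        p∥q = AllPairs-separated (EdgeDisjoint-sym G) {Q = _≡ p} P-disjoint p∈P q∈P refl q≢p

      R : List (List (Fin n))
      R = filter (∁? meets?) P

      Q : List (List (Fin n))
      Q = (z ∷ p) ∷ T ∷ R

      R-members : ∀ {r} → r ∈ R → r ∈ P × ¬ Meets r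
      R-members = ∈-filter⁻ (∁? meets?)

      zp-path : IsPath G (z ∷ p)
      zp-path = (Adj-sym G xz ∷ p~) , (¬Any⇒All¬ p z∉p ∷ p!) , s≤s (s≤s z≤n)

      zp∥T : EdgeDisjoint G (z ∷ p) T
      zp∥T u v e e′ with edge-∷⁻ G e | edge-∋-middle G e′
      ... | inj₁ (refl , refl)        | inj₁ z≡y = y≢z (sym z≡y)
      ... | inj₁ (refl , refl)        | inj₂ x≡y = x≢y x≡y
      ... | inj₂ (inj₁ (refl , refl)) | inj₁ x≡y = x≢y x≡y
      ... | inj₂ (inj₁ (refl , refl)) | inj₂ z≡y = y≢z (sym z≡y)
      ... | inj₂ (inj₂ e″)            | _        = no-edge-in-T e″ (edge-∈ G e′) (edge-∈ G (edge-sym G e′))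

      zp∥R : ∀ {r} → r ∈ R → EdgeDisjoint G (z ∷ p) r
      zp∥R r∈R u v e e′ with R-members r∈R | edge-∷⁻ G e
      ... | _   , ¬mr | inj₁ (refl , refl)        = ¬mr (meets (edge-∈ G e′) z∈T)
      ... | _   , ¬mr | inj₂ (inj₁ (refl , refl)) = ¬mr (meets (edge-∈ G e′) x∈T)
      ... | r∈P , ¬mr | inj₂ (inj₂ e″)            =
        AllPairs-separated (EdgeDisjoint-sym G) {Q = Meets} P-disjoint p∈P r∈P p-meets ¬mr u v e″ e′

      T∥R : ∀ {r} → r ∈ R → EdgeDisjoint G T r
      T∥R r∈R u v e e′ = proj₂ (R-members r∈R) (meets (edge-∈ G e′) (edge-∈ G e))

      T-edge-covered : ∀ {u v} → u ∈ T → v ∈ T → u ≢ v → ∃ λ r → r ∈ Q × EdgeOf G r u v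
      T-edge-covered (here refl)                 (here refl)                 u≢v = ⊥-elim (u≢v refl)
      T-edge-covered (here refl)                 (there (here refl))         _   = T , there (here refl) , inj₁ here
      T-edge-covered (here refl)                 (there (there (here refl))) _   = z ∷ p , here refl , inj₂ here
      T-edge-covered (there (here refl))         (here refl)                 _   = T , there (here refl) , inj₂ here
      T-edge-covered (there (here refl))         (there (here refl))         u≢v = ⊥-elim (u≢v refl)
      T-edge-covered (there (here refl))         (there (there (here refl))) _   = T , there (here refl) , inj₁ (there here)
      T-edge-covered (there (there (here refl))) (here refl)                 _   = z ∷ p , here refl , inj₁ here
      T-edge-covered (there (there (here refl))) (there (here refl))         _   = T , there (here refl) , inj₂ (there here)
      T-edge-covered (there (there (here refl))) (there (there (here refl))) u≢v = ⊥-elim (u≢v refl)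

      Q-covers : Covers G Q
      Q-covers u v uv with P-covers u v uv
      ... | q , q∈P , e with ≡-dec _≟_ q p
      ... | yes refl = z ∷ p , here refl , edge-∷ G e
      ... | no q≢p with meets? q
      ... | no ¬mq = q , there (there (∈-filter⁺ (∁? meets?) q∈P ¬mq)) , e
      ... | yes mq = T-edge-covered (All.lookup q⊆T (edge-∈ G e)) (All.lookup q⊆T (edge-∈ G (edge-sym G e)))
                                    (Adj⇒≢ G uv)
        where
        q⊆T : All (_∈ T) q
        q⊆T = meeting-path-⊆T q∈P q≢p mq

      Q-partition : PathPartition G Q
      Q-partition = PathPartition-intro G
        (zp-path ∷ T-path ∷ All.filter⁺ (∁? meets?) P-paths)
        ((zp∥T ∷ All.tabulate zp∥R) ∷ All.tabulate T∥R ∷ AllPairs.filter⁺ (∁? meets?) P-disjoint)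
        Q-covers

      meets-and-≢p : ∀ {q u v} → EdgeOf G q u v → u ∈ T → v ∈ T → Meets q × q ≢ p
      meets-and-≢p e u∈T v∈T = meets (edge-∈ G e) u∈T , λ { refl → no-edge-in-T e u∈T v∈T }

      three-meet : ∀ {q q′} → q ∈ P → q′ ∈ P → Meets q × q ≢ p → Meets q′ × q′ ≢ p → q ≢ q′ →
                   3 ≤ length (filter meets? P)
      three-meet q∈P q′∈P (mq , q≢p) (mq′ , q′≢p) q≢q′ =
        Unique-⊆⇒length≤length-filter meets?
          ((≢-sym q≢p ∷ ≢-sym q′≢p ∷ []) ∷ (q≢q′ ∷ []) ∷ [] ∷ []) (p-meets ∷ mq ∷ mq′ ∷ [])
          λ { (here refl) → p∈P ; (there (here refl)) → q∈P ; (there (there (here refl))) → q′∈P }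

      at-least-three-meet : 3 ≤ length (filter meets? P)
      at-least-three-meet with P-covers x y xy | P-covers y z yz | P-covers x z xz
      ... | q₁ , q₁∈P , e₁ | q₂ , q₂∈P , e₂ | q₃ , q₃∈P , e₃ with ≡-dec _≟_ q₁ q₂ | ≡-dec _≟_ q₁ q₃
      ... | no q₁≢q₂ | _ =
        three-meet q₁∈P q₂∈P (meets-and-≢p e₁ x∈T y∈T) (meets-and-≢p e₂ y∈T z∈T) q₁≢q₂
      ... | yes _ | no q₁≢q₃ =
        three-meet q₁∈P q₃∈P (meets-and-≢p e₁ x∈T y∈T) (meets-and-≢p e₃ x∈T z∈T) q₁≢q₃
      ... | yes refl | yes refl = ⊥-elim (triangle⊈path G (All.lookup P-paths q₁∈P) e₁ e₂ e₃)

      shorter-partition : ∃ λ Q → PathPartition G Q × length Q < length P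
      shorter-partition = Q , Q-partition ,
        subst (3 + length R ≤_) (length-filter+length-filter-∁ meets? P)
              (+-monoˡ-≤ (length R) at-least-three-meet)

  short-bull-path : ∀ {a rest} → IsPath G (x ∷ a ∷ rest) → lastOr G a rest ≡ y → a ∈ T →
                    All (_∈ T) (x ∷ a ∷ rest)
  short-bull-path (_ , (x∉ ∷ _) , _) _ (here refl) = ⊥-elim (All.lookup x∉ (here refl) refl)
  short-bull-path (_ , (_ ∷ a!) , _) ends (there (here refl)) with lastOr≡head⇒[] G a! ends
  ... | refl = x∈T ∷ y∈T ∷ []
  short-bull-path {rest = []} _ ends (there (there (here refl))) = ⊥-elim (y≢z (sym ends))
  short-bull-path {rest = r ∷ rs} (p~ , (x∉ ∷ _ ∷ r!) , _) ends (there (there (here refl)))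
    with neighbours-z (consec-adj G p~ (there here))
  ... | here refl = ⊥-elim (All.lookup x∉ (there (here refl)) refl)
  ... | there (here refl) with lastOr≡head⇒[] G r! ends
  ...   | refl = x∈T ∷ z∈T ∷ y∈T ∷ []

  bull-path-⊆T : ∀ {P} → PathPartition G P → (∀ Q → PathPartition G Q → length P ≤ length Q) →
                 ∀ {xs} → (x ∷ xs) ∈ P → lastOr G x xs ≡ y → All (_∈ T) (x ∷ xs)
  bull-path-⊆T P-partition _ {[]} p∈P _ with All.lookup (proj₁ P-partition) p∈P
  ... | _ , _ , s≤s ()
  bull-path-⊆T P-partition minimal {a ∷ rest} p∈P p-ends with any? (a ≟_) T
  ... | yes a∈T = short-bull-path (All.lookup (proj₁ P-partition) p∈P) p-ends a∈T
  ... | no a∉T with Detour.shorter-partition (All.lookup (proj₁ P-partition) p∈P) p-ends a∉T P-partition p∈P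
  ...   | Q , Q-partition , Q<P = ⊥-elim (<⇒≱ Q<P (minimal Q Q-partition))

lemma10 : ∀ {n : ℕ} (G : Graph n) → Nice G
          → (P : List (List (Fin n))) → PathPartition G P
          → (∀ (Q : List (List (Fin n))) → PathPartition G Q → length P ≤ length Q)
          → ∀ p → p ∈ P → (∃ λ v → v ∈ p × 4 ≤ deg G v)
          → BullFreePath G p
lemma10 G _ P P-partition minimal [] _ _ = tt
lemma10 G _ P P-partition minimal (x ∷ xs) p∈P (w , w∈p , 4≤deg-w) bull
  with bullPair⇒BullTriangle G bull
... | z , triangle = ≤⇒≯ (deg≤3 (All.lookup (bull-path-⊆T P-partition minimal p∈P refl) w∈p)) 4≤deg-w
  where open Exchange G triangle
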